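{- Let $\mathcal{G}$ be a marked simple graph with countable vertex set $I$. For every $q\in\mathbb{Z}$ we have, as formal power series in $\mathbb{C}[[x_i:i\in I]]$, $$\mathcal{I}(\mathcal{G},\mathbf{x})^q=\sum_{\mathbf{m}\in \mathbb{Z}_+^{I}} {_{\mathbf{m}}\Pi^{\mathrm{mark}}_\mathcal{G}}(q)\ x^\mathbf{m}.$$
   Context: $\mathcal{G}$ has edge set $E$ and marking $I_1^{\mathrm{it}}\subseteq I_1\subseteq I$ (vertices of $I_1^{\mathrm{it}}$ are odd isotropic); $\mathbb{Z}_+^I$ denotes finitely supported tuples of non-negative integers and $x^{\mathbf{m}}=\prod_i x_i^{m_i}$. $\mathcal{I}(\mathcal{G})$ is the set of finite multisets $U$ of vertices such that distinct elements of $U$ are non-adjacent and vertices outside $I_1^{\mathrm{it}}$ occur at most once ($\emptyset$ included); $\mathcal{I}(\mathcal{G},\mathbf{x})=\sum_{U\in\mathcal{I}(\mathcal{G})}\prod_i x_i^{(\text{mult. of } i \text{ in } U)}$. For $q\in\mathbb{N}$, ${_{\mathbf{m}}\Pi^{\mathrm{mark}}_\mathcal{G}}(q)$ is the number of maps $\Gamma$ from $I$ to finite multisubsets of $\{1,\dots,q\}$ with $\Gamma(i)$ a set for $i\notin I_1^{\mathrm{it}}$, $|\Gamma(i)|=m_i$ (with multiplicity), and $\Gamma(i)\cap\Gamma(j)=\emptyset$ for adjacent $i,j$. For fixed $\mathbf{m}$ this function of $q\in\mathbb{N}$ is given by a polynomial in $q$ (the marked chromatic polynomial), and ${_{\mathbf{m}}\Pi^{\mathrm{mark}}_\mathcal{G}}(q)$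 for $q\in\mathbb{Z}$ means this polynomial evaluated at $q$; for $\mathbf{m}=0$ it is $1$. -}

module Defs where

open import Data.Bool using (Bool; true; false; if_then_else_; _∧_; _∨_; not)
open import Data.Nat as ℕ using (ℕ; zero; suc; _∸_; _≡ᵇ_; _≤ᵇ_)
open import Data.Integer as ℤ using (ℤ; +_; -[1+_])
open import Data.Rational as ℚ using (ℚ; 0ℚ; 1ℚ; _/_)
open import Data.List using (List; []; _∷_; map; concatMap; upTo; length; filterᵇ; foldr; deduplicate)
open import Data.List.Membership.Propositional using (_∈_)
open import Data.Bool.ListAction using (and)
open import Data.Product using (_×_; _,_; proj₁; proj₂)
open import Function.Definitions using (Injective)
open import Relation.Binary.PropositionalEquality using (_≡_; _≢_; refl; cong)
open import Relation.Binary.Definitions using (DecidableEquality)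
open import Relation.Nullary using (yes; no; does)
open import Relation.Nullary.Decidable using (map′)

-- Marked simple graphs with countable vertex set.
-- "Countable" = the vertex type injects into ℕ (covers finite and
-- countably infinite I).  Adjacency is a Bool-valued symmetric,
-- irreflexive relation.  `odd` marks I₁, `iso` marks I₁^it ⊆ I₁.

record MarkedGraph : Set₁ where
  field
    I        : Set
    enc      : I → ℕ
    enc-inj  : Injective _≡_ _≡_ enc
    adj      : I → I → Bool
    adj-sym  : ∀ i j → adj i j ≡ adj j i
    adj-irr  : ∀ i → adj i i ≡ false
    odd      : I → Bool
    iso      : I → Bool
    iso⊆odd  : ∀ i → iso i ≡ true → odd i ≡ true

allᵇ : {A : Set} → (A → Bool) → List A → Bool
allᵇ p xs = and (map p xs)

module _ (G : MarkedGraph) where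
  open MarkedGraph G

  _≟V_ : DecidableEquality I
  i ≟V j = map′ enc-inj (cong enc) (enc i ℕ.≟ enc j)

  -- A monomial is given by
  -- an exponent function m : I → ℕ together with a list L of vertices
  -- containing its support (a "valid" pair).  Formal power series over ℚ
  -- are functions on such pairs; two series are equal when they agree on
  -- all valid pairs.

  Mono : Set
  Mono = List I × (I → ℕ)

  Valid : Mono → Set
  Valid (L , m) = ∀ i → m i ≢ 0 → i ∈ L

  FPS : Set
  FPS = Mono → ℚ

  _≈_ : FPS → FPS → Set
  f ≈ g = ∀ (μ : Mono) → Valid μ → f μ ≡ g μ

  dsupp : List I → List I
  dsupp L = deduplicate _≟V_ L

  -- all exponent functions a with a i ≤ m i for i ∈ L and a i = 0 off L
  -- (L assumed repetition-free)
  subExps : List I → (I → ℕ) → List (I → ℕ)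
  subExps []      m = (λ _ → 0) ∷ []
  subExps (i ∷ L) m =
    concatMap (λ a → map (λ e → λ j → if does (j ≟V i) then e else a j)
                         (upTo (suc (m i))))
              (subExps L m)

  sumℚ : List ℚ → ℚ
  sumℚ = foldr ℚ._+_ 0ℚ

  oneS : FPS
  oneS (L , m) = if allᵇ (λ i → m i ≡ᵇ 0) L then 1ℚ else 0ℚ

  _*S_ : FPS → FPS → FPS
  (f *S g) (L , m) =
    sumℚ (map (λ a → f (L , a) ℚ.* g (L , λ j → m j ∸ a j))
              (subExps (dsupp L) m))

  _^S_ : FPS → ℕ → FPS
  f ^S zero  = oneS
  f ^S suc n = f *S (f ^S n)

  -- q-th power for q ∈ ℤ of a series f with constant term 1:
  -- for q = n ≥ 0, f^q = f^n; for q = -(n+1) < 0, f^q is the (unique)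
  -- inverse of f^(n+1), i.e. the series g with g · f^(n+1) = 1.
  IsPowerOf : FPS → ℤ → FPS → Set
  IsPowerOf f (+ n)      g = (f ^S n) ≈ g
  IsPowerOf f -[1+ n ]   g = (g *S (f ^S suc n)) ≈ oneS

  -- The independence series I(G,x): the coefficient of x^m is 1 iff the
  -- multiset U with multiplicities m lies in 𝓘(G), i.e. distinct vertices
  -- of U are non-adjacent and vertices outside I₁^it have multiplicity ≤ 1.

  isIndep : Mono → Bool
  isIndep (L , m) =
    allᵇ (λ i → iso i ∨ (m i ≤ᵇ 1)) D ∧
    allᵇ (λ i → allᵇ (λ j → not (pos i ∧ pos j ∧ not (does (i ≟V j)) ∧ adj i j)) D) D
    where
    D = dsupp L
    pos : I → Bool
    pos i = not (m i ≡ᵇ 0)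

  indepSeries : FPS
  indepSeries μ = if isIndep μ then 1ℚ else 0ℚ

  -- Marked chromatic counts.  A finite multisubset of {1,…,q} is its
  -- multiplicity list (length q).  msets q k = all multisubsets of size k.

  msets : ℕ → ℕ → List (List ℕ)
  msets zero    zero    = [] ∷ []
  msets zero    (suc k) = []
  msets (suc q) k = concatMap (λ e → map (e ∷_) (msets q (k ∸ e))) (upTo (suc k))

  isSet : List ℕ → Bool
  isSet = allᵇ (λ c → c ≤ᵇ 1)

  choices : ℕ → (I → ℕ) → I → List (List ℕ)
  choices q m i = if iso i then msets q (m i) else filterᵇ isSet (msets q (m i))

  -- all maps Γ on the (repetition-free) list D, as lists of pairs (i , Γ i)
  assignments : ℕ → (I → ℕ) → List I → List (List (I × List ℕ))
  assignments q m []      = [] ∷ []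
  assignments q m (i ∷ D) =
    concatMap (λ A → map ((i , A) ∷_) (assignments q m D)) (choices q m i)

  disjoint : List ℕ → List ℕ → Bool
  disjoint []       _        = true
  disjoint (_ ∷ _)  []       = true
  disjoint (a ∷ as) (b ∷ bs) = not (not (a ≡ᵇ 0) ∧ not (b ≡ᵇ 0)) ∧ disjoint as bs

  proper : List (I × List ℕ) → Bool
  proper Γ = allᵇ (λ p → allᵇ (λ r → not (adj (proj₁ p) (proj₁ r)) ∨ disjoint (proj₂ p) (proj₂ r)) Γ) Γ

  -- _mΠ^mark_G(q) for q ∈ ℕ (vertices outside the support of m get Γ(i)=∅,
  -- which is forced, so only vertices of the support list are enumerated)
  chromCount : Mono → ℕ → ℕ
  chromCount (L , m) q = length (filterᵇ proper (assignments q m (dsupp L)))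

  -- Polynomials with rational coefficients (coefficient list, constant
  -- term first) and their evaluation.

  evalP : List ℚ → ℚ → ℚ
  evalP []       x = 0ℚ
  evalP (c ∷ cs) x = c ℚ.+ x ℚ.* evalP cs x

  ℕtoℚ : ℕ → ℚ
  ℕtoℚ n = + n / 1

  ℤtoℚ : ℤ → ℚ
  ℤtoℚ z = z / 1

  IsMarkedChromPoly : (Mono → List ℚ) → Set
  IsMarkedChromPoly P = ∀ (μ : Mono) → Valid μ → ∀ (q : ℕ) →
    evalP (P μ) (ℕtoℚ q) ≡ ℕtoℚ (chromCount μ q)

  chromSeries : (Mono → List ℚ) → ℤ → FPS
  chromSeries P q μ = evalP (P μ) (ℤtoℚ q)

-- For q = n ≥ 0 both sides count proper marked colourings with n colours.
-- Splitting the colours {1,…,k+y} into the first k and the last y (on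
-- multiplicity lists: concatenation) gives the convolution identity
--   Π_m(k + y) = Σ_{a ≤ m} Π_a(k) · Π_{m−a}(y),
-- and Π_m(0) = [m = 0], Π_m(1) = [m ∈ 𝓘(G)], so I(G,x)^n has coefficients Π_m(n).
-- For q = −(n+1), fix y = n+1 in the convolution identity: both sides are
-- polynomials in k that agree on ℕ, hence also at k = −(n+1), where the
-- identity reads Σ_a Π_a(−n−1) Π_{m−a}(n+1) = Π_m(0) = [m = 0]; that is, the
-- series with coefficients Π_m(−n−1) inverts I(G,x)^{n+1}.  The extrapolation
-- from ℕ to the negative integers uses only that a power of the difference
-- operator Δf(x) = f(x+1) − f(x) kills every polynomial.

module Submission where

open import Algebra.Bundles using (Ring; CommutativeMonoid)
open import Data.Bool using (Bool; true; false; if_then_else_; _∧_; _∨_; not; T; T?)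
open import Data.Bool.Properties
  using (∧-assoc; ∧-identityʳ; ∨-zeroʳ; ∨-distribˡ-∧; ∧-commutativeMonoid; T-≡; ⇔→≡)
open import Data.Integer as ℤ using (ℤ; -[1+_])
open import Data.Integer.Tactic.RingSolver using (solve-∀)
open import Data.List
  using (List; []; _∷_; _++_; map; concatMap; upTo; length; filterᵇ; foldr; zipWith; deduplicate)
open import Data.List.Properties using (map-cong; map-cong-local; map-upTo; map-∘)
open import Data.List.Membership.Propositional using (_∈_)
open import Data.List.Relation.Binary.Pointwise using (Pointwise; []; _∷_)
open import Data.List.Relation.Unary.All as All using (All; []; _∷_)
import Data.List.Relation.Unary.All.Properties as All
open import Data.List.Relation.Unary.Any using (here; there)
import Data.List.Relation.Unary.Any.Properties as Any
open import Data.List.Relation.Unary.AllPairs using ([]; _∷_)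
open import Data.List.Relation.Unary.Unique.Propositional using (Unique)
import Data.List.Relation.Unary.Unique.DecPropositional.Properties as UniqueDec
open import Data.Nat using (ℕ; zero; suc; _+_; _*_; _∸_; _≡ᵇ_; _≤ᵇ_; _≤_; z≤n; s≤s)
open import Data.Nat.ListAction using (sum)
open import Data.Nat.Properties
  using (suc-injective; +-identityʳ; +-assoc; *-distribˡ-+; *-distribʳ-+; *-zeroʳ; m+n∸m≡n; ∸-+-assoc;
         m≤m+n; m≤n+m; +-commutativeSemigroup)
open import Data.Nat.Coprimality using (1-coprimeTo)
import Data.Nat.Coprimality as Coprime
open import Data.Empty using (⊥-elim)
open import Data.Product using (_×_; _,_; proj₁; proj₂; ∃-syntax)
open import Data.Rational as ℚ using (ℚ; 0ℚ; 1ℚ; mkℚ; _/_)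
import Data.Rational.Properties as ℚ
open import Data.Rational.Solver using (module +-*-Solver)
import Data.Rational.Unnormalised as ℚᵘ
import Data.Rational.Unnormalised.Properties as ℚᵘ
open import Function using (_∘_; mk⇔; Equivalence)
open import Relation.Binary.Definitions using (DecidableEquality)
open import Relation.Binary.PropositionalEquality
open import Relation.Nullary using (Dec; yes; no; does)
open import Relation.Nullary.Decidable using (dec-true; dec-false)

open import Algebra.Properties.CommutativeSemigroup +-commutativeSemigroup
  using () renaming (interchange to +-interchange)
open import Algebra.Properties.CommutativeSemigroup
  (CommutativeMonoid.commutativeSemigroup ∧-commutativeMonoid)
  using () renaming (interchange to ∧-interchange)
open import Algebra.Properties.Semiring.Mult (Ring.semiring ℚ.+-*-ring)
  using (×-homo-+; ×1-homo-*) renaming (_×_ to _·_)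
open import Algebra.Properties.Group ℚ.+-0-group using (x∙y⁻¹≈ε⇒x≈y)

open import Defs

open ≡-Reasoning

private
  variable
    A B C : Set

-- Finite sums of natural numbers

∑ : List A → (A → ℕ) → ℕ
∑ xs f = sum (map f xs)

syntax ∑ xs (λ x → e) = ∑[ x ∈ xs ] e

_∸ᶠ_ : (A → ℕ) → (A → ℕ) → A → ℕ
(m ∸ᶠ a) x = m x ∸ a x

∑-cong : ∀ (xs : List A) {f g : A → ℕ} → (∀ x → f x ≡ g x) → ∑ xs f ≡ ∑ xs g
∑-cong xs eq = cong sum (map-cong eq xs)

∑-cong-All : ∀ {P : A → Set} {xs : List A} {f g : A → ℕ} →
             All P xs → (∀ {x} → P x → f x ≡ g x) → ∑ xs f ≡ ∑ xs g
∑-cong-All ps eq = cong sum (map-cong-local (All.map eq ps))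

∑-zero : ∀ (xs : List A) → ∑[ x ∈ xs ] 0 ≡ 0
∑-zero []       = refl
∑-zero (x ∷ xs) = ∑-zero xs

∑-if : ∀ (xs : List A) b (f : A → ℕ) → ∑[ x ∈ xs ] (if b then f x else 0) ≡ (if b then ∑ xs f else 0)
∑-if xs true  f = refl
∑-if xs false f = ∑-zero xs

∑-++ : ∀ (xs ys : List A) f → ∑ (xs ++ ys) f ≡ ∑ xs f + ∑ ys f
∑-++ []       ys f = refl
∑-++ (x ∷ xs) ys f = trans (cong (f x +_) (∑-++ xs ys f)) (sym (+-assoc (f x) _ _))

∑-map : ∀ (g : A → B) xs f → ∑ (map g xs) f ≡ ∑ xs (f ∘ g)
∑-map g xs f = cong sum (sym (map-∘ xs))

∑-concatMap : ∀ (g : A → List B) xs f → ∑ (concatMap g xs) f ≡ ∑[ x ∈ xs ] ∑ (g x) f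
∑-concatMap g []       f = refl
∑-concatMap g (x ∷ xs) f =
  trans (∑-++ (g x) (concatMap g xs) f) (cong (∑ (g x) f +_) (∑-concatMap g xs f))

∑-+ : ∀ (xs : List A) f g → ∑[ x ∈ xs ] (f x + g x) ≡ ∑ xs f + ∑ xs g
∑-+ []       f g = refl
∑-+ (x ∷ xs) f g = trans (cong (f x + g x +_) (∑-+ xs f g)) (+-interchange (f x) (g x) _ _)

∑-*ˡ : ∀ (xs : List A) c f → ∑[ x ∈ xs ] (c * f x) ≡ c * ∑ xs f
∑-*ˡ []       c f = sym (*-zeroʳ c)
∑-*ˡ (x ∷ xs) c f = trans (cong (c * f x +_) (∑-*ˡ xs c f)) (sym (*-distribˡ-+ c (f x) _))

∑-*ʳ : ∀ (xs : List A) c f → ∑[ x ∈ xs ] (f x * c) ≡ ∑ xs f * c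
∑-*ʳ []       c f = refl
∑-*ʳ (x ∷ xs) c f = trans (cong (f x * c +_) (∑-*ʳ xs c f)) (sym (*-distribʳ-+ c (f x) _))

∑-*-∑ : ∀ (xs : List A) (ys : List B) f g →
        ∑[ x ∈ xs ] ∑[ y ∈ ys ] (f x * g y) ≡ ∑ xs f * ∑ ys g
∑-*-∑ xs ys f g = trans (∑-cong xs (λ x → ∑-*ˡ ys (f x) g)) (∑-*ʳ xs (∑ ys g) f)

∑-swap : ∀ (xs : List A) (ys : List B) (f : A → B → ℕ) →
         ∑[ x ∈ xs ] ∑[ y ∈ ys ] f x y ≡ ∑[ y ∈ ys ] ∑[ x ∈ xs ] f x y
∑-swap []       ys f = sym (∑-zero ys)
∑-swap (x ∷ xs) ys f =
  trans (cong (∑ ys (f x) +_) (∑-swap xs ys f)) (sym (∑-+ ys (f x) (λ y → ∑[ x′ ∈ xs ] f x′ y)))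

∑-filterᵇ : ∀ (p : A → Bool) xs f → ∑ (filterᵇ p xs) f ≡ ∑[ x ∈ xs ] (if p x then f x else 0)
∑-filterᵇ p []       f = refl
∑-filterᵇ p (x ∷ xs) f with p x
... | true  = cong (f x +_) (∑-filterᵇ p xs f)
... | false = ∑-filterᵇ p xs f

𝟙 : Bool → ℕ
𝟙 b = if b then 1 else 0

𝟙-∧ : ∀ a b → 𝟙 (a ∧ b) ≡ 𝟙 a * 𝟙 b
𝟙-∧ true  true  = refl
𝟙-∧ true  false = refl
𝟙-∧ false b     = refl

length-filterᵇ : ∀ (p : A → Bool) xs → length (filterᵇ p xs) ≡ ∑[ x ∈ xs ] 𝟙 (p x)
length-filterᵇ p []       = refl
length-filterᵇ p (x ∷ xs) with p x
... | true  = cong suc (length-filterᵇ p xs)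
... | false = length-filterᵇ p xs

∑-upTo-suc : ∀ n (F : ℕ → ℕ) → ∑ (upTo (suc n)) F ≡ F 0 + ∑ (upTo n) (F ∘ suc)
∑-upTo-suc n F = cong (F 0 +_) (trans (cong (λ xs → ∑ xs F) (sym (map-upTo suc n))) (∑-map suc (upTo n) F))

∑-upTo-last : ∀ s (F : ℕ → ℕ) → ∑[ e ∈ upTo (suc s) ] (if s ∸ e ≡ᵇ 0 then F e else 0) ≡ F s
∑-upTo-last zero    F = +-identityʳ (F 0)
∑-upTo-last (suc s) F =
  trans (∑-upTo-suc (suc s) (λ e → if suc s ∸ e ≡ᵇ 0 then F e else 0)) (∑-upTo-last s (F ∘ suc))

∑-antidiagonal : ∀ s (H : ℕ → ℕ → ℕ) →
  ∑[ i ∈ upTo (suc s) ] ∑[ j ∈ upTo (suc (s ∸ i)) ] H i (i + j) ≡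
  ∑[ e ∈ upTo (suc s) ] ∑[ i ∈ upTo (suc e) ] H i e
∑-antidiagonal zero    H = refl
∑-antidiagonal (suc s) H = begin
  ∑[ i ∈ upTo (suc (suc s)) ] ∑[ j ∈ upTo (suc (suc s ∸ i)) ] H i (i + j)
    ≡⟨ ∑-upTo-suc (suc s) (λ i → ∑[ j ∈ upTo (suc (suc s ∸ i)) ] H i (i + j)) ⟩
  ∑[ j ∈ upTo (suc (suc s)) ] H 0 j + ∑[ i ∈ upTo (suc s) ] ∑[ j ∈ upTo (suc (s ∸ i)) ] H′ i (i + j)
    ≡⟨ cong₂ _+_ (∑-upTo-suc (suc s) (H 0)) (∑-antidiagonal s H′) ⟩
  (H 0 0 + ∑[ e ∈ upTo (suc s) ] H 0 (suc e)) + ∑[ e ∈ upTo (suc s) ] ∑[ i ∈ upTo (suc e) ] H′ i e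
    ≡⟨ +-assoc (H 0 0) _ _ ⟩
  H 0 0 + (∑[ e ∈ upTo (suc s) ] H 0 (suc e) + ∑[ e ∈ upTo (suc s) ] ∑[ i ∈ upTo (suc e) ] H′ i e)
    ≡⟨ cong₂ _+_ (sym (+-identityʳ (H 0 0)))
                 (sym (∑-+ (upTo (suc s)) (H 0 ∘ suc) (λ e → ∑[ i ∈ upTo (suc e) ] H′ i e))) ⟩
  (H 0 0 + 0) + ∑[ e ∈ upTo (suc s) ] (H 0 (suc e) + ∑[ i ∈ upTo (suc e) ] H′ i e)
    ≡⟨ cong ((H 0 0 + 0) +_) (∑-cong (upTo (suc s)) (λ e → sym (∑-upTo-suc (suc e) (λ i → H i (suc e))))) ⟩
  (H 0 0 + 0) + ∑[ e ∈ upTo (suc s) ] ∑[ i ∈ upTo (suc (suc e)) ] H i (suc e)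
    ≡⟨ sym (∑-upTo-suc (suc s) (λ e → ∑[ i ∈ upTo (suc e) ] H i e)) ⟩
  ∑[ e ∈ upTo (suc (suc s)) ] ∑[ i ∈ upTo (suc e) ] H i e ∎
  where
  H′ : ℕ → ℕ → ℕ
  H′ i e = H (suc i) (suc e)

∧-if : ∀ a b (n : ℕ) → (if a ∧ b then n else 0) ≡ (if a then (if b then n else 0) else 0)
∧-if true  b n = refl
∧-if false b n = refl

de-Morgan : ∀ p q x → not x ∨ (not (p ∧ q) ∧ true) ≡ not (p ∧ q ∧ x)
de-Morgan true  true  true  = refl
de-Morgan true  true  false = refl
de-Morgan true  false x     = ∨-zeroʳ (not x)
de-Morgan false q     x     = ∨-zeroʳ (not x)

allᵇ-cong : ∀ {p q : A → Bool} (xs : List A) → (∀ x → p x ≡ q x) → allᵇ p xs ≡ allᵇ q xs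
allᵇ-cong xs eq = cong (foldr _∧_ true) (map-cong eq xs)

allᵇ-map : ∀ (f : A → B) (p : B → Bool) xs → allᵇ p (map f xs) ≡ allᵇ (p ∘ f) xs
allᵇ-map f p xs = cong (foldr _∧_ true) (sym (map-∘ xs))

allᵇ-true : ∀ (xs : List A) → allᵇ (λ _ → true) xs ≡ true
allᵇ-true []       = refl
allᵇ-true (x ∷ xs) = allᵇ-true xs

allᵇ-++ : ∀ (p : A → Bool) xs ys → allᵇ p (xs ++ ys) ≡ allᵇ p xs ∧ allᵇ p ys
allᵇ-++ p []       ys = refl
allᵇ-++ p (x ∷ xs) ys = trans (cong (p x ∧_) (allᵇ-++ p xs ys)) (sym (∧-assoc (p x) _ _))

allᵇ-zipWith : ∀ {R : A → B → Set} {f : A → B → C} {p : C → Bool} {q : A → Bool} {r : B → Bool} →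
               (∀ {x y} → R x y → p (f x y) ≡ q x ∧ r y) →
               ∀ {xs ys} → Pointwise R xs ys → allᵇ p (zipWith f xs ys) ≡ allᵇ q xs ∧ allᵇ r ys
allᵇ-zipWith                 split []         = refl
allᵇ-zipWith {q = q} {r = r} split {x ∷ xs} {y ∷ ys} (xy ∷ xys) =
  trans (cong₂ _∧_ (split xy) (allᵇ-zipWith {q = q} {r = r} split xys))
        (∧-interchange (q x) (r y) (allᵇ q xs) (allᵇ r ys))

allᵇ-deduplicate : ∀ (_≟_ : DecidableEquality A) (p : A → Bool) xs →
                   allᵇ p (deduplicate _≟_ xs) ≡ allᵇ p xs
allᵇ-deduplicate _≟_ p xs =
  ⇔→≡ (mk⇔ (via (All.deduplicate⁻ _≟_ (subst (T ∘ p)) xs)) (via {xs} (All.deduplicate⁺ _≟_)))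
  where
  via : ∀ {ys zs} → (All (T ∘ p) ys → All (T ∘ p) zs) → allᵇ p ys ≡ true → allᵇ p zs ≡ true
  via {ys} f = Equivalence.to T-≡ ∘ All.all⁻ p ∘ f ∘ All.all⁺ p ys ∘ Equivalence.from T-≡

-- The map ℕtoℚ of Defs, which carries an unused graph parameter.
fromℕ : ℕ → ℚ
fromℕ n = ℤ.+ n / 1

fromℕ-suc : ∀ n → fromℕ (suc n) ≡ 1ℚ ℚ.+ fromℕ n
fromℕ-suc n
  rewrite ℚ.normalize-coprime {n} (Coprime.sym (1-coprimeTo n))
        | ℚ.normalize-coprime {suc n} (Coprime.sym (1-coprimeTo (suc n)))
  = ℚ.toℚᵘ-injective (ℚᵘ.≃-trans (ℚᵘ.*≡* (numerators (ℤ.+ n)))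
                                  (ℚᵘ.≃-sym (ℚ.toℚᵘ-homo-+ 1ℚ (mkℚ (ℤ.+ n) 0 (Coprime.sym (1-coprimeTo n))))))
  where
  numerators : ∀ i → (ℤ.+ 1 ℤ.+ i) ℤ.* ℤ.+ 1 ≡ (ℤ.+ 1 ℤ.* ℤ.+ 1 ℤ.+ i ℤ.* ℤ.+ 1) ℤ.* ℤ.+ 1
  numerators = solve-∀

fromℕ≡·1ℚ : ∀ n → fromℕ n ≡ n · 1ℚ
fromℕ≡·1ℚ zero    = refl
fromℕ≡·1ℚ (suc n) = trans (fromℕ-suc n) (cong (1ℚ ℚ.+_) (fromℕ≡·1ℚ n))

fromℕ-+ : ∀ m n → fromℕ (m + n) ≡ fromℕ m ℚ.+ fromℕ n
fromℕ-+ m n = trans (fromℕ≡·1ℚ (m + n))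
                    (trans (×-homo-+ 1ℚ m n) (sym (cong₂ ℚ._+_ (fromℕ≡·1ℚ m) (fromℕ≡·1ℚ n))))

fromℕ-* : ∀ m n → fromℕ (m * n) ≡ fromℕ m ℚ.* fromℕ n
fromℕ-* m n = trans (fromℕ≡·1ℚ (m * n))
                    (trans (×1-homo-* m n) (sym (cong₂ ℚ._*_ (fromℕ≡·1ℚ m) (fromℕ≡·1ℚ n))))

if-1ℚ : ∀ b → (if b then 1ℚ else 0ℚ) ≡ fromℕ (𝟙 b)
if-1ℚ true  = refl
if-1ℚ false = refl

∑ℚ : List A → (A → ℚ) → ℚ
∑ℚ xs f = foldr ℚ._+_ 0ℚ (map f xs)

∑ℚ-cong : ∀ (xs : List A) {f g : A → ℚ} → (∀ x → f x ≡ g x) → ∑ℚ xs f ≡ ∑ℚ xs g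
∑ℚ-cong xs eq = cong (foldr ℚ._+_ 0ℚ) (map-cong eq xs)

∑ℚ-cong-All : ∀ {P : A → Set} {xs : List A} {f g : A → ℚ} →
              All P xs → (∀ {x} → P x → f x ≡ g x) → ∑ℚ xs f ≡ ∑ℚ xs g
∑ℚ-cong-All ps eq = cong (foldr ℚ._+_ 0ℚ) (map-cong-local (All.map eq ps))

∑ℚ-fromℕ : ∀ (xs : List A) f → ∑ℚ xs (fromℕ ∘ f) ≡ fromℕ (∑ xs f)
∑ℚ-fromℕ []       f = refl
∑ℚ-fromℕ (x ∷ xs) f = trans (cong (fromℕ (f x) ℚ.+_) (∑ℚ-fromℕ xs f)) (sym (fromℕ-+ (f x) _))

-- Finite differences

Δ : (ℚ → ℚ) → ℚ → ℚ
Δ f x = f (x ℚ.+ 1ℚ) ℚ.- f x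

-- Δᵈ f = 0.  On ℚ this does not force f to be a polynomial; only its values at integers are used.
ΔVanishes : ℕ → (ℚ → ℚ) → Set
ΔVanishes zero    f = ∀ x → f x ≡ 0ℚ
ΔVanishes (suc d) f = ΔVanishes d (Δ f)

ΔNilpotent : (ℚ → ℚ) → Set
ΔNilpotent f = ∃[ d ] ΔVanishes d f

module _ where
  open +-*-Solver

  Δ-+ : ∀ a b c e → (a ℚ.+ c) ℚ.- (b ℚ.+ e) ≡ (a ℚ.- b) ℚ.+ (c ℚ.- e)
  Δ-+ = solve 4 (λ a b c e → (a :+ c) :- (b :+ e) := (a :- b) :+ (c :- e)) refl

  Δ-neg : ∀ a b → ℚ.- a ℚ.- ℚ.- b ≡ ℚ.- (a ℚ.- b)
  Δ-neg = solve 2 (λ a b → :- a :- :- b := :- (a :- b)) refl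

  Δ-*ʳ : ∀ a b c → a ℚ.* c ℚ.- b ℚ.* c ≡ (a ℚ.- b) ℚ.* c
  Δ-*ʳ = solve 3 (λ a b c → a :* c :- b :* c := (a :- b) :* c) refl

  Δ-x* : ∀ x a b → (x ℚ.+ 1ℚ) ℚ.* a ℚ.- x ℚ.* b ≡ x ℚ.* (a ℚ.- b) ℚ.+ a
  Δ-x* = solve 3 (λ x a b → (x :+ con 1ℚ) :* a :- x :* b := x :* (a :- b) :+ a) refl

  shift-comm : ∀ x c → x ℚ.+ c ℚ.+ 1ℚ ≡ x ℚ.+ 1ℚ ℚ.+ c
  shift-comm = solve 2 (λ x c → x :+ c :+ con 1ℚ := x :+ con 1ℚ :+ c) refl

  step-back : ∀ a b → a ≡ b ℚ.- (b ℚ.- a)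
  step-back = solve 2 (λ a b → a := b :- (b :- a)) refl

  neg-suc+1 : ∀ x → ℚ.- (1ℚ ℚ.+ x) ℚ.+ 1ℚ ≡ ℚ.- x
  neg-suc+1 = solve 1 (λ x → :- (con 1ℚ :+ x) :+ con 1ℚ := :- x) refl

ΔVanishes-cong : ∀ d {f g : ℚ → ℚ} → (∀ x → f x ≡ g x) → ΔVanishes d f → ΔVanishes d g
ΔVanishes-cong zero    f≗g hf x = trans (sym (f≗g x)) (hf x)
ΔVanishes-cong (suc d) f≗g hf = ΔVanishes-cong d (λ x → cong₂ ℚ._-_ (f≗g (x ℚ.+ 1ℚ)) (f≗g x)) hf

ΔVanishes-suc : ∀ d {f} → ΔVanishes d f → ΔVanishes (suc d) f
ΔVanishes-suc zero        hf x = cong₂ ℚ._-_ (hf (x ℚ.+ 1ℚ)) (hf x)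
ΔVanishes-suc (suc d) {f} hf   = ΔVanishes-suc d {Δ f} hf

ΔVanishes-≤ : ∀ {d d′ f} → d ≤ d′ → ΔVanishes d f → ΔVanishes d′ f
ΔVanishes-≤ {d′ = zero}           z≤n        hf = hf
ΔVanishes-≤ {d′ = suc d′} {f = f} z≤n        hf = ΔVanishes-suc d′ (ΔVanishes-≤ {d′ = d′} {f} z≤n hf)
ΔVanishes-≤ {f = f}               (s≤s d≤d′) hf = ΔVanishes-≤ {f = Δ f} d≤d′ hf

ΔVanishes-+ : ∀ d {f g} → ΔVanishes d f → ΔVanishes d g → ΔVanishes d (λ x → f x ℚ.+ g x)
ΔVanishes-+ zero          hf hg x = cong₂ ℚ._+_ (hf x) (hg x)
ΔVanishes-+ (suc d) {f} {g} hf hg =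
  ΔVanishes-cong d (λ x → sym (Δ-+ (f (x ℚ.+ 1ℚ)) (f x) (g (x ℚ.+ 1ℚ)) (g x))) (ΔVanishes-+ d {Δ f} {Δ g} hf hg)

ΔVanishes-neg : ∀ d {f} → ΔVanishes d f → ΔVanishes d (λ x → ℚ.- f x)
ΔVanishes-neg zero        hf x = cong ℚ.-_ (hf x)
ΔVanishes-neg (suc d) {f} hf =
  ΔVanishes-cong d (λ x → sym (Δ-neg (f (x ℚ.+ 1ℚ)) (f x))) (ΔVanishes-neg d {Δ f} hf)

ΔVanishes-*ʳ : ∀ d {f} c → ΔVanishes d f → ΔVanishes d (λ x → f x ℚ.* c)
ΔVanishes-*ʳ zero        c hf x = trans (cong (ℚ._* c) (hf x)) (ℚ.*-zeroˡ c)
ΔVanishes-*ʳ (suc d) {f} c hf =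
  ΔVanishes-cong d (λ x → sym (Δ-*ʳ (f (x ℚ.+ 1ℚ)) (f x) c)) (ΔVanishes-*ʳ d {Δ f} c hf)

ΔVanishes-shift : ∀ d {f} c → ΔVanishes d f → ΔVanishes d (λ x → f (x ℚ.+ c))
ΔVanishes-shift zero        c hf x = hf (x ℚ.+ c)
ΔVanishes-shift (suc d) {f} c hf =
  ΔVanishes-cong d (λ x → cong (λ y → f y ℚ.- f (x ℚ.+ c)) (shift-comm x c)) (ΔVanishes-shift d {Δ f} c hf)

ΔVanishes-x* : ∀ d {g} → ΔVanishes d g → ΔVanishes (suc d) (λ x → x ℚ.* g x)
ΔVanishes-x* zero        hg = ΔVanishes-suc 0 (λ x → trans (cong (x ℚ.*_) (hg x)) (ℚ.*-zeroʳ x))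
ΔVanishes-x* (suc d) {g} hg =
  ΔVanishes-cong (suc d) (λ x → sym (Δ-x* x (g (x ℚ.+ 1ℚ)) (g x)))
    (ΔVanishes-+ (suc d) {λ x → x ℚ.* Δ g x} {λ x → g (x ℚ.+ 1ℚ)}
      (ΔVanishes-x* d {Δ g} hg) (ΔVanishes-shift (suc d) {g} 1ℚ hg))

ΔNilpotent-+ : ∀ {f g} → ΔNilpotent f → ΔNilpotent g → ΔNilpotent (λ x → f x ℚ.+ g x)
ΔNilpotent-+ {f} {g} (d , hf) (e , hg) =
  d + e , ΔVanishes-+ (d + e) {f} {g} (ΔVanishes-≤ (m≤m+n d e) hf) (ΔVanishes-≤ (m≤n+m e d) hg)

ΔNilpotent-neg : ∀ {f} → ΔNilpotent f → ΔNilpotent (λ x → ℚ.- f x)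
ΔNilpotent-neg (d , hf) = d , ΔVanishes-neg d hf

ΔNilpotent-*ʳ : ∀ {f} c → ΔNilpotent f → ΔNilpotent (λ x → f x ℚ.* c)
ΔNilpotent-*ʳ c (d , hf) = d , ΔVanishes-*ʳ d c hf

ΔNilpotent-shift : ∀ {f} c → ΔNilpotent f → ΔNilpotent (λ x → f (x ℚ.+ c))
ΔNilpotent-shift c (d , hf) = d , ΔVanishes-shift d c hf

ΔNilpotent-const : ∀ c → ΔNilpotent (λ _ → c)
ΔNilpotent-const c = 1 , λ _ → ℚ.+-inverseʳ c

ΔNilpotent-x* : ∀ {g} → ΔNilpotent g → ΔNilpotent (λ x → x ℚ.* g x)
ΔNilpotent-x* (d , hg) = suc d , ΔVanishes-x* d hg

ΔNilpotent-∑ℚ : ∀ (xs : List A) {F : A → ℚ → ℚ} → (∀ a → ΔNilpotent (F a)) →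
                ΔNilpotent (λ x → ∑ℚ xs (λ a → F a x))
ΔNilpotent-∑ℚ []       hF = 0 , λ _ → refl
ΔNilpotent-∑ℚ (a ∷ xs) hF = ΔNilpotent-+ (hF a) (ΔNilpotent-∑ℚ xs hF)

ΔNilpotent-evalP : ∀ (G : MarkedGraph) cs → ΔNilpotent (evalP G cs)
ΔNilpotent-evalP G []       = 0 , λ _ → refl
ΔNilpotent-evalP G (c ∷ cs) = ΔNilpotent-+ (ΔNilpotent-const c) (ΔNilpotent-x* (ΔNilpotent-evalP G cs))

vanishing-on-ℕ⇒vanishing-on-negatives : ∀ d {f} → ΔVanishes d f →
  (∀ k → f (fromℕ k) ≡ 0ℚ) → ∀ k → f (ℚ.- fromℕ k) ≡ 0ℚ
vanishing-on-ℕ⇒vanishing-on-negatives zero        hf _      k = hf _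
vanishing-on-ℕ⇒vanishing-on-negatives (suc d) {f} hf f∣ℕ≡0 = f∣ℕ⁻≡0
  where
  Δf∣ℕ≡0 : ∀ k → Δ f (fromℕ k) ≡ 0ℚ
  Δf∣ℕ≡0 k = cong₂ ℚ._-_ (trans (cong f (trans (ℚ.+-comm (fromℕ k) 1ℚ) (sym (fromℕ-suc k))))
                                (f∣ℕ≡0 (suc k)))
                         (f∣ℕ≡0 k)
  Δf∣ℕ⁻≡0 : ∀ k → Δ f (ℚ.- fromℕ k) ≡ 0ℚ
  Δf∣ℕ⁻≡0 = vanishing-on-ℕ⇒vanishing-on-negatives d {Δ f} hf Δf∣ℕ≡0
  f∣ℕ⁻≡0 : ∀ k → f (ℚ.- fromℕ k) ≡ 0ℚ
  f∣ℕ⁻≡0 zero    = f∣ℕ≡0 0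
  f∣ℕ⁻≡0 (suc k) = begin
    f (ℚ.- fromℕ (suc k))
      ≡⟨ step-back _ (f (ℚ.- fromℕ (suc k) ℚ.+ 1ℚ)) ⟩
    f (ℚ.- fromℕ (suc k) ℚ.+ 1ℚ) ℚ.- Δ f (ℚ.- fromℕ (suc k))
      ≡⟨ cong₂ ℚ._-_ (trans (cong f previous) (f∣ℕ⁻≡0 k)) (Δf∣ℕ⁻≡0 (suc k)) ⟩
    0ℚ ℚ.- 0ℚ
      ≡⟨⟩
    0ℚ ∎
    where
    previous : ℚ.- fromℕ (suc k) ℚ.+ 1ℚ ≡ ℚ.- fromℕ k
    previous = trans (cong (λ y → ℚ.- y ℚ.+ 1ℚ) (fromℕ-suc k)) (neg-suc+1 (fromℕ k))

agreeing-on-ℕ⇒agreeing-on-negatives : ∀ {f g} → ΔNilpotent f → ΔNilpotent g →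
  (∀ k → f (fromℕ k) ≡ g (fromℕ k)) → ∀ k → f (ℚ.- fromℕ k) ≡ g (ℚ.- fromℕ k)
agreeing-on-ℕ⇒agreeing-on-negatives {f} {g} nf ng f≡g k =
  let d , f-g-vanishes = ΔNilpotent-+ {f} nf (ΔNilpotent-neg {g} ng)
  in  x∙y⁻¹≈ε⇒x≈y _ _ (vanishing-on-ℕ⇒vanishing-on-negatives d f-g-vanishes f-g∣ℕ≡0 k)
  where
  f-g∣ℕ≡0 : ∀ k → f (fromℕ k) ℚ.- g (fromℕ k) ≡ 0ℚ
  f-g∣ℕ≡0 k = trans (cong (ℚ._- g (fromℕ k)) (f≡g k)) (ℚ.+-inverseʳ (g (fromℕ k)))

-- Counting colourings

module _ (G : MarkedGraph) where
  open MarkedGraph G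

  private
    _≟I_ : DecidableEquality I
    _≟I_ = _≟V_ G

  ∑-msets-suc : ∀ q s (g : List ℕ → ℕ) →
    ∑ (msets G (suc q) s) g ≡ ∑[ e ∈ upTo (suc s) ] ∑[ A ∈ msets G q (s ∸ e) ] g (e ∷ A)
  ∑-msets-suc q s g =
    trans (∑-concatMap (λ e → map (e ∷_) (msets G q (s ∸ e))) (upTo (suc s)) g)
          (∑-cong (upTo (suc s)) (λ e → ∑-map (e ∷_) (msets G q (s ∸ e)) g))

  ∑-msets-zero : ∀ t (h : List ℕ → ℕ) → ∑ (msets G 0 t) h ≡ (if t ≡ᵇ 0 then h [] else 0)
  ∑-msets-zero zero    h = +-identityʳ (h [])
  ∑-msets-zero (suc t) h = refl

  ∑-msets-one : ∀ s (g : List ℕ → ℕ) → ∑ (msets G 1 s) g ≡ g (s ∷ [])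
  ∑-msets-one s g = begin
    ∑ (msets G 1 s) g
      ≡⟨ ∑-msets-suc 0 s g ⟩
    ∑[ e ∈ upTo (suc s) ] ∑[ A ∈ msets G 0 (s ∸ e) ] g (e ∷ A)
      ≡⟨ ∑-cong (upTo (suc s)) (λ e → ∑-msets-zero (s ∸ e) (g ∘ (e ∷_))) ⟩
    ∑[ e ∈ upTo (suc s) ] (if s ∸ e ≡ᵇ 0 then g (e ∷ []) else 0)
      ≡⟨ ∑-upTo-last s (λ e → g (e ∷ [])) ⟩
    g (s ∷ []) ∎

  ∑-msets-+ : ∀ k y s (g : List ℕ → ℕ) →
    ∑ (msets G (k + y) s) g ≡
    ∑[ e ∈ upTo (suc s) ] ∑[ A ∈ msets G k e ] ∑[ B ∈ msets G y (s ∸ e) ] g (A ++ B)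
  ∑-msets-+ zero    y s g = sym (begin
    ∑[ e ∈ upTo (suc s) ] ∑[ A ∈ msets G 0 e ] ∑[ B ∈ msets G y (s ∸ e) ] g (A ++ B)
      ≡⟨ ∑-upTo-suc s (λ e → ∑[ A ∈ msets G 0 e ] ∑[ B ∈ msets G y (s ∸ e) ] g (A ++ B)) ⟩
    (∑ (msets G y s) g + 0) + ∑[ e ∈ upTo s ] 0
      ≡⟨ cong₂ _+_ (+-identityʳ _) (∑-zero (upTo s)) ⟩
    ∑ (msets G y s) g + 0
      ≡⟨ +-identityʳ _ ⟩
    ∑ (msets G y s) g ∎)
  ∑-msets-+ (suc k) y s g = begin
    ∑ (msets G (suc (k + y)) s) g
      ≡⟨ ∑-msets-suc (k + y) s g ⟩
    ∑[ i ∈ upTo (suc s) ] ∑[ A ∈ msets G (k + y) (s ∸ i) ] g (i ∷ A)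
      ≡⟨ ∑-cong (upTo (suc s)) (λ i → ∑-msets-+ k y (s ∸ i) (g ∘ (i ∷_))) ⟩
    ∑[ i ∈ upTo (suc s) ] ∑[ j ∈ upTo (suc (s ∸ i)) ]
      ∑[ A ∈ msets G k j ] ∑[ B ∈ msets G y (s ∸ i ∸ j) ] g (i ∷ A ++ B)
      ≡⟨ ∑-cong (upTo (suc s)) (λ i → ∑-cong (upTo (suc (s ∸ i))) (reindex i)) ⟩
    ∑[ i ∈ upTo (suc s) ] ∑[ j ∈ upTo (suc (s ∸ i)) ] H i (i + j)
      ≡⟨ ∑-antidiagonal s H ⟩
    ∑[ e ∈ upTo (suc s) ] ∑[ i ∈ upTo (suc e) ] H i e
      ≡⟨ ∑-cong (upTo (suc s)) (λ e → sym (∑-msets-suc k e (λ A → ∑[ B ∈ msets G y (s ∸ e) ] g (A ++ B)))) ⟩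
    ∑[ e ∈ upTo (suc s) ] ∑[ A ∈ msets G (suc k) e ] ∑[ B ∈ msets G y (s ∸ e) ] g (A ++ B) ∎
    where
    H : ℕ → ℕ → ℕ
    H i e = ∑[ A ∈ msets G k (e ∸ i) ] ∑[ B ∈ msets G y (s ∸ e) ] g (i ∷ A ++ B)
    reindex : ∀ i j → ∑[ A ∈ msets G k j ] ∑[ B ∈ msets G y (s ∸ i ∸ j) ] g (i ∷ A ++ B) ≡ H i (i + j)
    reindex i j = cong₂ (λ u v → ∑[ A ∈ msets G k u ] ∑[ B ∈ msets G y v ] g (i ∷ A ++ B))
                        (sym (m+n∸m≡n i j)) (∸-+-assoc s i j)

  msets-length : ∀ q s → All (λ A → length A ≡ q) (msets G q s)
  msets-length zero    zero    = refl ∷ []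
  msets-length zero    (suc s) = []
  msets-length (suc q) s       =
    All.concat⁺ (All.map⁺ (All.universal (λ e → All.map⁺ (All.map (cong suc) (msets-length q (s ∸ e))))
                                         (upTo (suc s))))

  -- choices G q m i unfolds to options (iso i) q (m i).
  options : Bool → ℕ → ℕ → List (List ℕ)
  options b q s = if b then msets G q s else filterᵇ (isSet G) (msets G q s)

  options-length : ∀ b q s → All (λ A → length A ≡ q) (options b q s)
  options-length true  q s = msets-length q s
  options-length false q s = All.filter⁺ (T? ∘ isSet G) (msets-length q s)

  ∑-options-zero : ∀ b s (g : List ℕ → ℕ) → ∑ (options b 0 s) g ≡ (if s ≡ᵇ 0 then g [] else 0)
  ∑-options-zero true  s g = ∑-msets-zero s g
  ∑-options-zero false s g = trans (∑-filterᵇ (isSet G) (msets G 0 s) g) (∑-msets-zero s _)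

  ∑-options-one : ∀ b s (g : List ℕ → ℕ) → ∑ (options b 1 s) g ≡ (if b ∨ (s ≤ᵇ 1) then g (s ∷ []) else 0)
  ∑-options-one true  s g = ∑-msets-one s g
  ∑-options-one false s g =
    trans (∑-filterᵇ (isSet G) (msets G 1 s) g)
          (trans (∑-msets-one s _) (cong (λ c → if c then g (s ∷ []) else 0) (∧-identityʳ (s ≤ᵇ 1))))

  ∑-options-+ : ∀ b k y s (g : List ℕ → ℕ) →
    ∑ (options b (k + y) s) g ≡
    ∑[ e ∈ upTo (suc s) ] ∑[ A ∈ options b k e ] ∑[ B ∈ options b y (s ∸ e) ] g (A ++ B)
  ∑-options-+ true  k y s g = ∑-msets-+ k y s g
  ∑-options-+ false k y s g = begin
    ∑ (filterᵇ set (msets G (k + y) s)) g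
      ≡⟨ ∑-filterᵇ set (msets G (k + y) s) g ⟩
    ∑[ A ∈ msets G (k + y) s ] (if set A then g A else 0)
      ≡⟨ ∑-msets-+ k y s (λ A → if set A then g A else 0) ⟩
    ∑[ e ∈ upTo (suc s) ] ∑[ A ∈ msets G k e ] ∑[ B ∈ msets G y (s ∸ e) ]
      (if set (A ++ B) then g (A ++ B) else 0)
      ≡⟨ ∑-cong (upTo (suc s)) (λ e → ∑-cong (msets G k e) (λ A → split A (msets G y (s ∸ e)))) ⟩
    ∑[ e ∈ upTo (suc s) ] ∑[ A ∈ msets G k e ]
      (if set A then ∑[ B ∈ filterᵇ set (msets G y (s ∸ e)) ] g (A ++ B) else 0)
      ≡⟨ ∑-cong (upTo (suc s)) (λ e → sym (∑-filterᵇ set (msets G k e) _)) ⟩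
    ∑[ e ∈ upTo (suc s) ] ∑[ A ∈ filterᵇ set (msets G k e) ] ∑[ B ∈ filterᵇ set (msets G y (s ∸ e)) ] g (A ++ B) ∎
    where
    set : List ℕ → Bool
    set = isSet G
    split : ∀ A Bs → ∑[ B ∈ Bs ] (if set (A ++ B) then g (A ++ B) else 0) ≡
                     (if set A then ∑[ B ∈ filterᵇ set Bs ] g (A ++ B) else 0)
    split A Bs = begin
      ∑[ B ∈ Bs ] (if set (A ++ B) then g (A ++ B) else 0)
        ≡⟨ ∑-cong Bs (λ B → trans (cong (λ c → if c then g (A ++ B) else 0) (allᵇ-++ (_≤ᵇ 1) A B))
                                   (∧-if (set A) (set B) _)) ⟩
      ∑[ B ∈ Bs ] (if set A then (if set B then g (A ++ B) else 0) else 0)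
        ≡⟨ ∑-if Bs (set A) _ ⟩
      (if set A then ∑[ B ∈ Bs ] (if set B then g (A ++ B) else 0) else 0)
        ≡⟨ cong (λ n → if set A then n else 0) (sym (∑-filterᵇ set Bs _)) ⟩
      (if set A then ∑[ B ∈ filterᵇ set Bs ] g (A ++ B) else 0) ∎

  Assignment : Set
  Assignment = List (I × List ℕ)

  assignments-cong : ∀ q {m m′} D → All (λ j → m j ≡ m′ j) D → assignments G q m D ≡ assignments G q m′ D
  assignments-cong q []      []         = refl
  assignments-cong q (i ∷ D) (eq ∷ eqs) =
    cong₂ (λ As Γs → concatMap (λ A → map ((i , A) ∷_) Γs) As)
          (cong (options (iso i) q) eq) (assignments-cong q D eqs)

  ∑-assignments-∷ : ∀ q {m m′ i s} D (F : Assignment → ℕ) → m i ≡ s → All (λ j → m j ≡ m′ j) D →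
    ∑ (assignments G q m (i ∷ D)) F ≡
    ∑[ A ∈ options (iso i) q s ] ∑[ Γ ∈ assignments G q m′ D ] F ((i , A) ∷ Γ)
  ∑-assignments-∷ q {m} {i = i} D F refl eqs =
    trans (∑-concatMap (λ A → map ((i , A) ∷_) (assignments G q m D)) (options (iso i) q (m i)) F)
          (∑-cong (options (iso i) q (m i))
             (λ A → trans (∑-map ((i , A) ∷_) (assignments G q m D) F)
                          (cong (λ Γs → ∑ Γs (F ∘ ((i , A) ∷_))) (assignments-cong q D eqs))))

  EntryFor : ℕ → I → I × List ℕ → Set
  EntryFor q i p = proj₁ p ≡ i × length (proj₂ p) ≡ q

  assignments-shape : ∀ q m D → All (Pointwise (EntryFor q) D) (assignments G q m D)
  assignments-shape q m []      = [] ∷ []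
  assignments-shape q m (i ∷ D) =
    All.concat⁺ (All.map⁺ (All.map (λ len → All.map⁺ (All.map ((refl , len) ∷_) (assignments-shape q m D)))
                                    (options-length (iso i) q (m i))))

  ∑-assignments-single : ∀ q m (ok : I → Bool) (val : I → List ℕ) →
    (∀ i g → ∑ (options (iso i) q (m i)) g ≡ (if ok i then g (val i) else 0)) →
    ∀ D (F : Assignment → ℕ) →
    ∑ (assignments G q m D) F ≡ (if allᵇ ok D then F (map (λ i → i , val i) D) else 0)
  ∑-assignments-single q m ok val single []      F = +-identityʳ (F [])
  ∑-assignments-single q m ok val single (i ∷ D) F =
    trans (∑-assignments-∷ q D F refl (All.universal (λ _ → refl) D)) (trans (single i _) (step (ok i)))
    where
    step : ∀ c → (if c then ∑[ Γ ∈ assignments G q m D ] F ((i , val i) ∷ Γ) else 0) ≡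
                 (if c ∧ allᵇ ok D then F ((i , val i) ∷ map (λ j → j , val j) D) else 0)
    step true  = ∑-assignments-single q m ok val single D (F ∘ ((i , val i) ∷_))
    step false = refl

  Separated : I × List ℕ → I × List ℕ → Bool
  Separated p r = not (adj (proj₁ p) (proj₁ r)) ∨ disjoint G (proj₂ p) (proj₂ r)

  proper-map : ∀ (f : I → I × List ℕ) D →
    proper G (map f D) ≡ allᵇ (λ i → allᵇ (λ j → Separated (f i) (f j)) D) D
  proper-map f D = trans (allᵇ-map f _ D) (allᵇ-cong D (λ i → allᵇ-map f (Separated (f i)) D))

  -- Glues a colouring with colours 1…k to one with colours k+1…k+y.
  mergeEntry : I × List ℕ → I × List ℕ → I × List ℕ
  mergeEntry (i , A) (_ , B) = i , A ++ B

  merge : Assignment → Assignment → Assignment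
  merge = zipWith mergeEntry

  Compatible : ℕ → I × List ℕ → I × List ℕ → Set
  Compatible k p r = proj₁ p ≡ proj₁ r × length (proj₂ p) ≡ k

  compatible : ∀ {k y D Γ₁ Γ₂} → Pointwise (EntryFor k) D Γ₁ → Pointwise (EntryFor y) D Γ₂ →
               Pointwise (Compatible k) Γ₁ Γ₂
  compatible []                  []                = []
  compatible ((i₁ , len) ∷ pw₁) ((i₂ , _) ∷ pw₂) = (trans i₁ (sym i₂) , len) ∷ compatible pw₁ pw₂

  disjoint-++ : ∀ A B A′ B′ → length A ≡ length B →
                disjoint G (A ++ A′) (B ++ B′) ≡ disjoint G A B ∧ disjoint G A′ B′
  disjoint-++ []      []      A′ B′ _  = refl
  disjoint-++ []      (_ ∷ _) A′ B′ ()
  disjoint-++ (_ ∷ _) []      A′ B′ ()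
  disjoint-++ (a ∷ A) (b ∷ B) A′ B′ eq =
    trans (cong (c ∧_) (disjoint-++ A B A′ B′ (suc-injective eq))) (sym (∧-assoc c _ _))
    where
    c = not (not (a ≡ᵇ 0) ∧ not (b ≡ᵇ 0))

  separated-merge : ∀ {k p p′ r r′} → Compatible k p p′ → Compatible k r r′ →
    Separated (mergeEntry p p′) (mergeEntry r r′) ≡ Separated p r ∧ Separated p′ r′
  separated-merge {p = i , A} {_ , A′} {j , B} {_ , B′} (refl , lenA) (refl , lenB) =
    trans (cong (not (adj i j) ∨_) (disjoint-++ A B A′ B′ (trans lenA (sym lenB))))
          (∨-distribˡ-∧ (not (adj i j)) _ _)

  proper-merge : ∀ {k Γ₁ Γ₂} → Pointwise (Compatible k) Γ₁ Γ₂ →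
                 proper G (merge Γ₁ Γ₂) ≡ proper G Γ₁ ∧ proper G Γ₂
  proper-merge pw =
    allᵇ-zipWith (λ {p} {p′} c → allᵇ-zipWith (λ {r} {r′} → separated-merge {p = p} {p′} {r} {r′} c) pw) pw

  _[_≔_] : (I → ℕ) → I → ℕ → I → ℕ
  (a [ i ≔ e ]) j = if does (j ≟I i) then e else a j

  ≔-same : ∀ a i e → (a [ i ≔ e ]) i ≡ e
  ≔-same a i e = cong (λ c → if c then e else a i) (dec-true (i ≟I i) refl)

  ≔-other : ∀ a {i j} e → i ≢ j → (a [ i ≔ e ]) j ≡ a j
  ≔-other a {i} {j} e i≢j = cong (λ c → if c then e else a j) (dec-false (j ≟I i) (i≢j ∘ sym))

  ≔-support : ∀ {D} a i e → (∀ j → a j ≢ 0 → j ∈ D) → ∀ j → (a [ i ≔ e ]) j ≢ 0 → j ∈ i ∷ D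
  ≔-support a i e supp j nz with j ≟I i
  ... | yes j≡i = here j≡i
  ... | no  j≢i = there (supp j (nz ∘ trans (≔-other a e (j≢i ∘ sym))))

  ∑-subExps-∷ : ∀ i D m (F : (I → ℕ) → ℕ) →
    ∑ (subExps G (i ∷ D) m) F ≡ ∑[ a ∈ subExps G D m ] ∑[ e ∈ upTo (suc (m i)) ] F (a [ i ≔ e ])
  ∑-subExps-∷ i D m F =
    trans (∑-concatMap (λ a → map (a [ i ≔_]) (upTo (suc (m i)))) (subExps G D m) F)
          (∑-cong (subExps G D m) (λ a → ∑-map (a [ i ≔_]) (upTo (suc (m i))) F))

  subExps-support : ∀ D m → All (λ a → ∀ j → a j ≢ 0 → j ∈ D) (subExps G D m)
  subExps-support []      m = (λ j nz → ⊥-elim (nz refl)) ∷ []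
  subExps-support (i ∷ D) m =
    All.concat⁺ (All.map⁺ (All.map (λ supp → All.map⁺ (All.universal (λ e → ≔-support _ i e supp) _))
                                    (subExps-support D m)))

  subExps-valid : ∀ L m → All (λ a → Valid G (L , a)) (subExps G (dsupp G L) m)
  subExps-valid L m =
    All.map (λ supp j nz → Any.deduplicate⁻ (_≟V_ G) (supp j nz)) (subExps-support (dsupp G L) m)

  mergedSum : ℕ → ℕ → (I → ℕ) → (I → ℕ) → List I → (Assignment → ℕ) → ℕ
  mergedSum k y a b D F = ∑[ Γ₁ ∈ assignments G k a D ] ∑[ Γ₂ ∈ assignments G y b D ] F (merge Γ₁ Γ₂)

  mergedSum-∷ : ∀ k y {a a′ b b′ i e s} D (F : Assignment → ℕ) →
    a′ i ≡ e → b′ i ≡ s → All (λ j → a′ j ≡ a j) D → All (λ j → b′ j ≡ b j) D →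
    mergedSum k y a′ b′ (i ∷ D) F ≡
    ∑[ A₁ ∈ options (iso i) k e ] ∑[ A₂ ∈ options (iso i) y s ] mergedSum k y a b D (F ∘ ((i , A₁ ++ A₂) ∷_))
  mergedSum-∷ k y {a} {a′} {b} {b′} {i} {e} {s} D F a′i≡e b′i≡s a′≗a b′≗b = begin
    mergedSum k y a′ b′ (i ∷ D) F
      ≡⟨ ∑-cong (assignments G k a′ (i ∷ D)) (λ Γ₁ → ∑-assignments-∷ y D (F ∘ merge Γ₁) b′i≡s b′≗b) ⟩
    ∑[ Γ₁ ∈ assignments G k a′ (i ∷ D) ] ∑[ A₂ ∈ options (iso i) y s ] ∑[ Γ₂ ∈ assignments G y b D ]
      F (merge Γ₁ ((i , A₂) ∷ Γ₂))
      ≡⟨ ∑-assignments-∷ k D _ a′i≡e a′≗a ⟩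
    ∑[ A₁ ∈ options (iso i) k e ] ∑[ Γ₁ ∈ assignments G k a D ] ∑[ A₂ ∈ options (iso i) y s ]
      ∑[ Γ₂ ∈ assignments G y b D ] F ((i , A₁ ++ A₂) ∷ merge Γ₁ Γ₂)
      ≡⟨ ∑-cong (options (iso i) k e) (λ A₁ → ∑-swap (assignments G k a D) (options (iso i) y s) _) ⟩
    ∑[ A₁ ∈ options (iso i) k e ] ∑[ A₂ ∈ options (iso i) y s ] mergedSum k y a b D (F ∘ ((i , A₁ ++ A₂) ∷_)) ∎

  ∑-assignments-+ : ∀ k y m {D} → Unique D → (F : Assignment → ℕ) →
    ∑ (assignments G (k + y) m D) F ≡ ∑[ a ∈ subExps G D m ] mergedSum k y a (m ∸ᶠ a) D F
  ∑-assignments-+ k y m {[]}    []         F = sym (trans (+-identityʳ _) (+-identityʳ _))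
  ∑-assignments-+ k y m {i ∷ D} (i∉D ∷ D!) F = begin
    ∑ (assignments G (k + y) m (i ∷ D)) F
      ≡⟨ ∑-assignments-∷ (k + y) D F refl (All.universal (λ _ → refl) D) ⟩
    ∑[ A ∈ options b (k + y) (m i) ] ∑[ Γ ∈ assignments G (k + y) m D ] F ((i , A) ∷ Γ)
      ≡⟨ ∑-cong (options b (k + y) (m i)) (λ A → ∑-assignments-+ k y m D! (F ∘ ((i , A) ∷_))) ⟩
    ∑[ A ∈ options b (k + y) (m i) ] ∑[ a ∈ subExps G D m ] R a A
      ≡⟨ ∑-swap (options b (k + y) (m i)) (subExps G D m) (λ A a → R a A) ⟩
    ∑[ a ∈ subExps G D m ] ∑[ A ∈ options b (k + y) (m i) ] R a A
      ≡⟨ ∑-cong (subExps G D m) (λ a → ∑-options-+ b k y (m i) (R a)) ⟩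
    ∑[ a ∈ subExps G D m ] ∑[ e ∈ upTo (suc (m i)) ]
      ∑[ A₁ ∈ options b k e ] ∑[ A₂ ∈ options b y (m i ∸ e) ] R a (A₁ ++ A₂)
      ≡⟨ ∑-cong (subExps G D m) (λ a → ∑-cong (upTo (suc (m i))) (λ e →
           sym (mergedSum-∷ k y D F (≔-same a i e) (cong (m i ∸_) (≔-same a i e))
                            (unchanged a e) (All.map (cong (m _ ∸_)) (unchanged a e))))) ⟩
    ∑[ a ∈ subExps G D m ] ∑[ e ∈ upTo (suc (m i)) ] S (a [ i ≔ e ])
      ≡⟨ sym (∑-subExps-∷ i D m S) ⟩
    ∑[ a ∈ subExps G (i ∷ D) m ] S a ∎
    where
    b = iso i
    R : (I → ℕ) → List ℕ → ℕ
    R a A = mergedSum k y a (m ∸ᶠ a) D (F ∘ ((i , A) ∷_))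
    S : (I → ℕ) → ℕ
    S a = mergedSum k y a (m ∸ᶠ a) (i ∷ D) F
    unchanged : ∀ a e → All (λ j → (a [ i ≔ e ]) j ≡ a j) D
    unchanged a e = All.map (≔-other a e) i∉D

  chromCount≡∑ : ∀ L m q → chromCount G (L , m) q ≡ ∑[ Γ ∈ assignments G q m (dsupp G L) ] 𝟙 (proper G Γ)
  chromCount≡∑ L m q = length-filterᵇ (proper G) (assignments G q m (dsupp G L))

  chromCount-+ : ∀ L m k y → chromCount G (L , m) (k + y) ≡
    ∑[ a ∈ subExps G (dsupp G L) m ] (chromCount G (L , a) k * chromCount G (L , m ∸ᶠ a) y)
  chromCount-+ L m k y = begin
    chromCount G (L , m) (k + y)
      ≡⟨ chromCount≡∑ L m (k + y) ⟩
    ∑[ Γ ∈ assignments G (k + y) m D ] 𝟙 (proper G Γ)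
      ≡⟨ ∑-assignments-+ k y m (UniqueDec.deduplicate-! (_≟V_ G) L) (𝟙 ∘ proper G) ⟩
    ∑[ a ∈ subExps G D m ] ∑[ Γ₁ ∈ assignments G k a D ] ∑[ Γ₂ ∈ assignments G y (m ∸ᶠ a) D ]
      𝟙 (proper G (merge Γ₁ Γ₂))
      ≡⟨ ∑-cong (subExps G D m) (λ a →
           ∑-cong-All (assignments-shape k a D) (λ {Γ₁} shape₁ →
             ∑-cong-All (assignments-shape y (m ∸ᶠ a) D) (λ {Γ₂} shape₂ →
               trans (cong 𝟙 (proper-merge (compatible shape₁ shape₂))) (𝟙-∧ (proper G Γ₁) (proper G Γ₂))))) ⟩
    ∑[ a ∈ subExps G D m ] ∑[ Γ₁ ∈ assignments G k a D ] ∑[ Γ₂ ∈ assignments G y (m ∸ᶠ a) D ]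
      (𝟙 (proper G Γ₁) * 𝟙 (proper G Γ₂))
      ≡⟨ ∑-cong (subExps G D m) (λ a → ∑-*-∑ (assignments G k a D) (assignments G y (m ∸ᶠ a) D)
                                             (𝟙 ∘ proper G) (𝟙 ∘ proper G)) ⟩
    ∑[ a ∈ subExps G D m ] (∑[ Γ₁ ∈ assignments G k a D ] 𝟙 (proper G Γ₁) *
                            ∑[ Γ₂ ∈ assignments G y (m ∸ᶠ a) D ] 𝟙 (proper G Γ₂))
      ≡⟨ ∑-cong (subExps G D m) (λ a → sym (cong₂ _*_ (chromCount≡∑ L a k) (chromCount≡∑ L (m ∸ᶠ a) y))) ⟩
    ∑[ a ∈ subExps G D m ] (chromCount G (L , a) k * chromCount G (L , m ∸ᶠ a) y) ∎
    where
    D = dsupp G L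

  chromCount-zero : ∀ L m → chromCount G (L , m) 0 ≡ 𝟙 (allᵇ (λ i → m i ≡ᵇ 0) L)
  chromCount-zero L m = begin
    chromCount G (L , m) 0
      ≡⟨ chromCount≡∑ L m 0 ⟩
    ∑[ Γ ∈ assignments G 0 m D ] 𝟙 (proper G Γ)
      ≡⟨ ∑-assignments-single 0 m empty? (λ _ → []) (λ i → ∑-options-zero (iso i) (m i)) D (𝟙 ∘ proper G) ⟩
    (if allᵇ empty? D then 𝟙 (proper G (map (λ i → i , []) D)) else 0)
      ≡⟨ cong (λ c → if allᵇ empty? D then 𝟙 c else 0) proper-empty ⟩
    𝟙 (allᵇ empty? D)
      ≡⟨ cong 𝟙 (allᵇ-deduplicate (_≟V_ G) empty? L) ⟩
    𝟙 (allᵇ empty? L) ∎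
    where
    D = dsupp G L
    empty? : I → Bool
    empty? i = m i ≡ᵇ 0
    proper-empty : proper G (map (λ i → i , []) D) ≡ true
    proper-empty =
      trans (proper-map _ D)
            (trans (allᵇ-cong D (λ i → trans (allᵇ-cong D (λ j → ∨-zeroʳ (not (adj i j)))) (allᵇ-true D)))
                   (allᵇ-true D))

  chromCount-one : ∀ L a → chromCount G (L , a) 1 ≡ 𝟙 (isIndep G (L , a))
  chromCount-one L a = begin
    chromCount G (L , a) 1
      ≡⟨ chromCount≡∑ L a 1 ⟩
    ∑[ Γ ∈ assignments G 1 a D ] 𝟙 (proper G Γ)
      ≡⟨ ∑-assignments-single 1 a ok (λ i → a i ∷ []) (λ i → ∑-options-one (iso i) (a i)) D (𝟙 ∘ proper G) ⟩
    (if allᵇ ok D then 𝟙 (proper G (map (λ i → i , a i ∷ []) D)) else 0)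
      ≡⟨ sym (∧-if (allᵇ ok D) _ 1) ⟩
    𝟙 (allᵇ ok D ∧ proper G (map (λ i → i , a i ∷ []) D))
      ≡⟨ cong (λ c → 𝟙 (allᵇ ok D ∧ c)) proper-singletons ⟩
    𝟙 (isIndep G (L , a)) ∎
    where
    D = dsupp G L
    ok pos : I → Bool
    ok i = iso i ∨ (a i ≤ᵇ 1)
    pos i = not (a i ≡ᵇ 0)
    separated-singletons : ∀ i j → Separated (i , a i ∷ []) (j , a j ∷ []) ≡
                                  not (pos i ∧ pos j ∧ not (does (i ≟I j)) ∧ adj i j)
    separated-singletons i j = by-cases (i ≟I j)
      where
      by-cases : (d : Dec (i ≡ j)) → Separated (i , a i ∷ []) (j , a j ∷ []) ≡
                                     not (pos i ∧ pos j ∧ not (does d) ∧ adj i j)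
      by-cases (yes i≡j) rewrite trans (cong (adj i) (sym i≡j)) (adj-irr i) = de-Morgan (pos i) (pos j) false
      by-cases (no  _)   = de-Morgan (pos i) (pos j) (adj i j)
    proper-singletons : proper G (map (λ i → i , a i ∷ []) D) ≡
                        allᵇ (λ i → allᵇ (λ j → not (pos i ∧ pos j ∧ not (does (i ≟I j)) ∧ adj i j)) D) D
    proper-singletons = trans (proper-map _ D) (allᵇ-cong D (λ i → allᵇ-cong D (separated-singletons i)))

  -- Powers of the independence series

  indepSeries-^ : ∀ n μ → _^S_ G (indepSeries G) n μ ≡ fromℕ (chromCount G μ n)
  indepSeries-^ zero    (L , m) =
    trans (if-1ℚ (allᵇ (λ i → m i ≡ᵇ 0) L)) (cong fromℕ (sym (chromCount-zero L m)))
  indepSeries-^ (suc n) (L , m) = begin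
    ∑ℚ xs (λ a → indepSeries G (L , a) ℚ.* _^S_ G (indepSeries G) n (L , m ∸ᶠ a))
      ≡⟨ ∑ℚ-cong xs term ⟩
    ∑ℚ xs (fromℕ ∘ count)
      ≡⟨ ∑ℚ-fromℕ xs count ⟩
    fromℕ (∑ xs count)
      ≡⟨ cong fromℕ (sym (chromCount-+ L m 1 n)) ⟩
    fromℕ (chromCount G (L , m) (suc n)) ∎
    where
    xs = subExps G (dsupp G L) m
    count : (I → ℕ) → ℕ
    count a = chromCount G (L , a) 1 * chromCount G (L , m ∸ᶠ a) n
    term : ∀ a → indepSeries G (L , a) ℚ.* _^S_ G (indepSeries G) n (L , m ∸ᶠ a) ≡ fromℕ (count a)
    term a = begin
      indepSeries G (L , a) ℚ.* _^S_ G (indepSeries G) n (L , m ∸ᶠ a)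
        ≡⟨ cong₂ ℚ._*_ (if-1ℚ (isIndep G (L , a))) (indepSeries-^ n (L , m ∸ᶠ a)) ⟩
      fromℕ (𝟙 (isIndep G (L , a))) ℚ.* fromℕ (chromCount G (L , m ∸ᶠ a) n)
        ≡⟨ cong (λ c → fromℕ c ℚ.* fromℕ (chromCount G (L , m ∸ᶠ a) n)) (sym (chromCount-one L a)) ⟩
      fromℕ (chromCount G (L , a) 1) ℚ.* fromℕ (chromCount G (L , m ∸ᶠ a) n)
        ≡⟨ sym (fromℕ-* (chromCount G (L , a) 1) (chromCount G (L , m ∸ᶠ a) n)) ⟩
      fromℕ (count a) ∎

  module _ (P : Mono G → List ℚ) (P-chrom : IsMarkedChromPoly G P) where

    markedChromPoly-+ : ∀ L m → Valid G (L , m) → ∀ k y →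
      evalP G (P (L , m)) (fromℕ k ℚ.+ fromℕ y) ≡
      ∑ℚ (subExps G (dsupp G L) m) (λ a → evalP G (P (L , a)) (fromℕ k) ℚ.* fromℕ (chromCount G (L , m ∸ᶠ a) y))
    markedChromPoly-+ L m valid k y = begin
      evalP G (P (L , m)) (fromℕ k ℚ.+ fromℕ y)
        ≡⟨ cong (evalP G (P (L , m))) (sym (fromℕ-+ k y)) ⟩
      evalP G (P (L , m)) (fromℕ (k + y))
        ≡⟨ P-chrom (L , m) valid (k + y) ⟩
      fromℕ (chromCount G (L , m) (k + y))
        ≡⟨ cong fromℕ (chromCount-+ L m k y) ⟩
      fromℕ (∑[ a ∈ xs ] (chromCount G (L , a) k * chromCount G (L , m ∸ᶠ a) y))
        ≡⟨ sym (∑ℚ-fromℕ xs (λ a → chromCount G (L , a) k * chromCount G (L , m ∸ᶠ a) y)) ⟩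
      ∑ℚ xs (λ a → fromℕ (chromCount G (L , a) k * chromCount G (L , m ∸ᶠ a) y))
        ≡⟨ ∑ℚ-cong-All (subExps-valid L m) (λ {a} valid-a →
             trans (fromℕ-* (chromCount G (L , a) k) (chromCount G (L , m ∸ᶠ a) y))
                   (cong (ℚ._* _) (sym (P-chrom (L , a) valid-a k)))) ⟩
      ∑ℚ xs (λ a → evalP G (P (L , a)) (fromℕ k) ℚ.* fromℕ (chromCount G (L , m ∸ᶠ a) y)) ∎
      where
      xs = subExps G (dsupp G L) m

    chromSeries-inverse : ∀ n μ → Valid G μ →
      _*S_ G (chromSeries G P -[1+ n ]) (_^S_ G (indepSeries G) (suc n)) μ ≡ oneS G μ
    chromSeries-inverse n (L , m) valid = begin
      ∑ℚ xs (λ a → evalP G (P (L , a)) (ℚ.- Y) ℚ.* _^S_ G (indepSeries G) (suc n) (L , m ∸ᶠ a))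
        ≡⟨ ∑ℚ-cong xs (λ a → cong (evalP G (P (L , a)) (ℚ.- Y) ℚ.*_) (indepSeries-^ (suc n) (L , m ∸ᶠ a))) ⟩
      convolution (ℚ.- Y)
        ≡⟨ agreeing-on-ℕ⇒agreeing-on-negatives {convolution} {shifted}
             (ΔNilpotent-∑ℚ xs (λ a → ΔNilpotent-*ʳ _ (ΔNilpotent-evalP G (P (L , a)))))
             (ΔNilpotent-shift Y (ΔNilpotent-evalP G (P (L , m))))
             (λ k → sym (markedChromPoly-+ L m valid k (suc n))) (suc n) ⟩
      evalP G (P (L , m)) (ℚ.- Y ℚ.+ Y)
        ≡⟨ cong (evalP G (P (L , m))) (ℚ.+-inverseˡ Y) ⟩
      evalP G (P (L , m)) 0ℚ
        ≡⟨ P-chrom (L , m) valid 0 ⟩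
      fromℕ (chromCount G (L , m) 0)
        ≡⟨ sym (indepSeries-^ 0 (L , m)) ⟩
      oneS G (L , m) ∎
      where
      Y = fromℕ (suc n)  -- ℚ.- Y is ℤtoℚ G -[1+ n ] by definition
      xs = subExps G (dsupp G L) m
      convolution shifted : ℚ → ℚ
      convolution x = ∑ℚ xs (λ a → evalP G (P (L , a)) x ℚ.* fromℕ (chromCount G (L , m ∸ᶠ a) (suc n)))
      shifted x = evalP G (P (L , m)) (x ℚ.+ Y)

theorem3p3 : (G : MarkedGraph) (P : Mono G → List ℚ) →
    IsMarkedChromPoly G P →
    (q : ℤ) → IsPowerOf G (indepSeries G) q (chromSeries G P q)
theorem3p3 G P P-chrom (ℤ.+ n)    μ valid = trans (indepSeries-^ G n μ) (sym (P-chrom μ valid n))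
theorem3p3 G P P-chrom -[1+ n ] μ valid = chromSeries-inverse G P P-chrom n μ valid
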